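{- Let $S=s_1,\dots,s_m$ be a sequence over a totally ordered set and, for $1\le i\le m$, let $T_i$ be the augmented tree defined in the context. Let $F=\{i : s_i\notin\{s_1,\dots,s_{i-1}\}\}$ be the set of indices of first occurrences. Then there is a procedure that, given $S$ and accessing its elements only via binary comparisons, constructs $T_m$ using at most \[\sum_{i\in F\setminus\{1\}}\bigl(\lceil\log(i-1)\rceil+3\bigr)+\sum_{i\notin F}\left(\left\lceil\log\frac{i-1}{\#_{s_i}(s_1,\dots,s_{i-1})}\right\rceil+3\right)\] binary comparisons.
   Context: Logarithms are base 2; a binary comparison of $x,y$ reveals only whether $x\le y$. $\#_a(R)$ denotes the number of occurrences of $a$ in sequence $R$. For $1\le i\le m$, let $a_1<\dots<a_t$ be the distinct elements of $s_1,\dots,s_i$ and $c_j=\#_{a_j}(s_1,\dots,s_i)$. Put $f_j=\sum_{k<j}\frac{c_k}{i}+\frac{c_j}{2i}$ and let $\sigma_j$ be the first $\lceil\log(i/c_j)\rceil+1$ bits of the binary expansion of $f_j$ (these strings are prefix-free and lexicographically increasing). $T_i$ is the binary tree whose leaves are exactly the nodes reached from the root along the paths $\sigma_1,\dots,\sigma_t$ (bit $0$ = left edge, bit $1$ = right edge), with the $j$th leaf storing $a_j$; each internal node with two children stores a pointer to the rightmost leaf of its left subtree. $T_i$ is augmented so that the leaf storing $a_j$ also stores a counter equal to $c_j$ and a list of the indices of the occurrences of $a_j$ in $s_1,\dots,s_i$. -}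

module Defs where

open import Data.Bool using (Bool; true; false; if_then_else_; not)
open import Data.Nat using (ℕ; zero; suc; _+_; _*_; _∸_; _^_; _≤_; _≤ᵇ_; _≡ᵇ_; ⌊_/2⌋)
open import Data.Nat.DivMod using (_/_; _%_)
open import Data.Fin using (Fin)
open import Data.Vec using (Vec; lookup; toList)
open import Data.List using (List; []; _∷_; _++_; length; map; filter; deduplicate; any)
open import Data.Maybe using (Maybe; just; nothing)
open import Data.Product using (_×_; _,_; proj₁)
open import Relation.Nullary using (yes; no; does)
open import Relation.Binary.PropositionalEquality using (_≡_)
open import Relation.Binary.Structures using (IsDecTotalOrder)

-- clog a b = least k (searched in 0..a) with a ≤ b * 2^k.
-- For a ≥ b ≥ 1 this is exactly ⌈log₂ (a / b)⌉.
clogGo : ℕ → ℕ → ℕ → ℕ → ℕ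
clogGo a b zero    k = k
clogGo a b (suc f) k = if a ≤ᵇ b * 2 ^ k then k else clogGo a b f (suc k)

clog : ℕ → ℕ → ℕ
clog a b = clogGo a b (suc a) 0

shiftR : ℕ → ℕ → ℕ
shiftR zero    n = n
shiftR (suc L) n = ⌊ shiftR L n /2⌋

bits : ℕ → ℕ → List Bool
bits zero    n = []
bits (suc L) n = (shiftR L n % 2 ≡ᵇ 1) ∷ bits L n

data BTree (D P : Set) : Set where
  leaf  : D → BTree D P
  onlyL : BTree D P → BTree D P
  onlyR : BTree D P → BTree D P
  both  : BTree D P → P → BTree D P → BTree D P

mapTree : {D P D' P' : Set} → (D → D') → (P → P') → BTree D P → BTree D' P'
mapTree f g (leaf d)     = leaf (f d)
mapTree f g (onlyL t)    = onlyL (mapTree f g t)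
mapTree f g (onlyR t)    = onlyR (mapTree f g t)
mapTree f g (both l p r) = both (mapTree f g l) (g p) (mapTree f g r)

rightmost : {D P : Set} → BTree D P → D
rightmost (leaf d)     = d
rightmost (onlyL t)    = rightmost t
rightmost (onlyR t)    = rightmost t
rightmost (both l p r) = rightmost r

branch : {D : Set} → Bool → List (List Bool × D) → List (List Bool × D)
branch b []                    = []
branch b (([] , d) ∷ xs)       = branch b xs
branch true  ((true  ∷ c , d) ∷ xs) = (c , d) ∷ branch true xs
branch true  ((false ∷ c , d) ∷ xs) = branch true xs
branch false ((false ∷ c , d) ∷ xs) = (c , d) ∷ branch false xs
branch false ((true  ∷ c , d) ∷ xs) = branch false xs

hasEmpty : {D : Set} → List (List Bool × D) → Bool
hasEmpty []             = false
hasEmpty (([] , _) ∷ _) = true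
hasEmpty (_ ∷ xs)       = hasEmpty xs

-- The binary tree whose leaves are exactly the nodes reached from the root
-- along the given codewords (0 = left, 1 = right), the leaf at codeword σ
-- storing the associated datum; every node with two children stores
-- key (datum of the rightmost leaf of its left subtree).
-- The first argument is recursion fuel (an upper bound on the depth);
-- `nothing` is returned if the fuel is insufficient or the codewords are not
-- a nonempty prefix-free set.
trie : {D P : Set} → (D → P) → ℕ → List (List Bool × D) → Maybe (BTree D P)
trie key n       []                = nothing
trie key n       (([] , d) ∷ [])   = just (leaf d)
trie key zero    (_ ∷ _)           = nothing
trie key (suc n) xs with hasEmpty xs
... | true  = nothing
... | false with branch false xs | branch true xs
...   | []    | []    = nothing
...   | L ∷ Ls | []    with trie key n (L ∷ Ls)
...     | just l  = just (onlyL l)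
...     | nothing = nothing
trie key (suc n) xs | false | [] | R ∷ Rs with trie key n (R ∷ Rs)
...     | just r  = just (onlyR r)
...     | nothing = nothing
trie key (suc n) xs | false | L ∷ Ls | R ∷ Rs with trie key n (L ∷ Ls) | trie key n (R ∷ Rs)
...     | just l  | just r = just (both l (key (rightmost l)) r)
...     | _       | _      = nothing

module Seq {A : Set} {_≤_ : A → A → Set} (O : IsDecTotalOrder _≡_ _≤_) where
  open IsDecTotalOrder O using (_≟_; _≤?_)

  count# : A → List A → ℕ
  count# a []       = 0
  count# a (x ∷ xs) = if does (x ≟ a) then suc (count# a xs) else count# a xs

  -- 1-based indices of the occurrences of a in the list, starting at index k
  indicesFrom : ℕ → A → List A → List ℕ
  indicesFrom k a []       = []
  indicesFrom k a (x ∷ xs) =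
    if does (x ≟ a) then k ∷ indicesFrom (suc k) a xs else indicesFrom (suc k) a xs

  indicesOf : A → List A → List ℕ
  indicesOf = indicesFrom 1

  insert : A → List A → List A
  insert a []       = a ∷ []
  insert a (x ∷ xs) = if does (a ≤? x) then a ∷ x ∷ xs else x ∷ insert a xs

  isort : List A → List A
  isort []       = []
  isort (x ∷ xs) = insert x (isort xs)

  distinctSorted : List A → List A
  distinctSorted xs = isort (deduplicate _≟_ xs)

  -- Leaf data: (a_j , c_j , list of indices of occurrences of a_j)
  LeafData : Set
  LeafData = A × ℕ × List ℕ

  -- codewords σ_j for the sequence xs of length i = suc n.
  -- f_j = (2 C_j + c_j) / (2 i), where C_j = Σ_{k<j} c_k;
  -- σ_j = first ⌈log(i/c_j)⌉+1 bits of f_j, i.e. the L-bit representation of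
  -- ⌊ f_j · 2^L ⌋ = ⌊ (2 C_j + c_j) 2^L / (2 i) ⌋.
  codesGo : (n : ℕ) → List A → ℕ → List A → List (List Bool × LeafData)
  codesGo n xs C []       = []
  codesGo n xs C (a ∷ as) =
    let c = count# a xs
        L = suc (clog (suc n) c)
    in (bits L (((2 * C + c) * 2 ^ L) / (2 * suc n)) , (a , c , indicesOf a xs))
       ∷ codesGo n xs (C + c) as

  codes : (n : ℕ) → List A → List (List Bool × LeafData)
  codes n xs = codesGo n xs 0 (distinctSorted xs)

  -- T_i for a sequence s_1,…,s_i with i = suc n (as a list xs of length i);
  -- `just T` when the construction succeeds (fuel 2 + i is ample).
  treeT : (n : ℕ) → List A → Maybe (BTree LeafData A)
  treeT n xs = trie proj₁ (suc (suc (suc n))) (codes n xs)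

  -- The comparison bound, as a sum over i = 1..m. `pre` = s_1..s_{i-1}.
  term : List A → A → ℕ
  term []        x = 0
  term (p ∷ ps)  x with count# x (p ∷ ps)
  ... | zero    = clog (length (p ∷ ps)) 1 + 3           -- i ∈ F, i ≠ 1
  ... | suc c   = clog (length (p ∷ ps)) (suc c) + 3     -- i ∉ F

  boundGo : List A → List A → ℕ
  boundGo pre []       = 0
  boundGo pre (x ∷ xs) = term pre x + boundGo (pre ++ (x ∷ [])) xs

  bound : List A → ℕ
  bound = boundGo []

-- Comparison-based procedures (decision trees) on inputs of length m.
-- `ask i j k` compares s_i ≤ s_j and continues with k true / k false.

data CompTree (m : ℕ) (O : Set) : Set where
  ret : O → CompTree m O
  ask : Fin m → Fin m → (Bool → CompTree m O) → CompTree m O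

run : {A : Set} {_≤_ : A → A → Set} → IsDecTotalOrder _≡_ _≤_ →
      {m : ℕ} {O : Set} → Vec A m → CompTree m O → O × ℕ
run O s (ret o)     = o , 0
run O s (ask i j k) with run O s (k (does (IsDecTotalOrder._≤?_ O (lookup s i) (lookup s j))))
... | o , c = o , suc c

-- The output format of a procedure on input of length m: elements are
-- referred to by (an index of) one of their occurrences in S.
Out : ℕ → Set
Out m = BTree (Fin m × ℕ × List ℕ) (Fin m)

decode : {A : Set} {m : ℕ} → Vec A m → Out m → BTree (A × ℕ × List ℕ) A
decode s = mapTree (λ { (i , c , l) → lookup s i , c , l }) (lookup s)

{-# OPTIONS --safe #-}
-- The procedure reads s₁, s₂, … once. After i elements it knows the distinct values seen so
-- far only through representatives (indices into S) sorted by value, and the sequence of ranks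
-- of s₁ … s_i among them. The tree T_i of the rank sequence is built without comparing
-- elements of S, and s_{i+1} is located in it by walking down: one comparison with the
-- representative of the rightmost leaf of the left subtree at each binary node, and two at the
-- leaf reached, which decide between equality and the gaps on either side. The leaf of a_j has
-- depth |σ_j| = ⌈log(i/c_j)⌉ + 1, so ending there costs at most ⌈log(i/c_j)⌉ + 3. If s_{i+1} = a_j
-- the walk ends at that leaf, which is the budget; if s_{i+1} is new it ends at some leaf, and
-- c_j ≥ 1 bounds the cost by ⌈log i⌉ + 3.
--
-- The σ_j are the paths of a tree, i.e. prefix-free and increasing, because for j < j′ we have
-- f_{j′} − f_j ≥ (c_j + c_{j′})/(2i) ≥ 2^(−l) for l the shorter of |σ_j| and |σ_{j′}|, so the
-- truncations to length l already differ. Finally, T_m of S is the relabelling of T_m of the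
-- rank sequence, since the construction only compares elements and ranks compare like the
-- values they stand for.

module Submission where

open import Defs

open import Data.Bool using (Bool; true; false; if_then_else_; T)
open import Data.Empty using (⊥-elim)
open import Data.Fin as Fin using (Fin; toℕ; inject₁; punchIn)
import Data.Fin.Properties as FinProps
open import Data.List using (List; []; _∷_; _++_; length; take; map; deduplicate; filter; tabulate; allFin)
open import Data.List.Membership.Propositional using (_∈_)
open import Data.List.Membership.Propositional.Properties using (∈-map⁺; ∈-++⁺ˡ; ∈-++⁺ʳ)
open import Data.List.Properties
  using (length-++; length-map; length-tabulate; ++-identityʳ; ++-assoc; map-++; map-∘; map-cong; map-tabulate)
open import Data.List.Relation.Unary.All as All using (All; []; _∷_; universal)
open import Data.List.Relation.Unary.All.Properties using (deduplicate⁺; tabulate⁺; map⁺)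
open import Data.List.Relation.Unary.AllPairs using (AllPairs; []; _∷_)
open import Data.List.Relation.Unary.Any using (here; there)
open import Data.List.Relation.Unary.Unique.Propositional.Properties using (allFin⁺)
open import Data.Maybe using (Maybe; just; nothing; maybe′)
import Data.Maybe as Maybe
open import Data.Nat hiding (_≟_; _≤?_)
open import Data.Nat.DivMod
open import Data.Nat.Divisibility using (∣-refl)
open import Data.Nat.ListAction using (sum)
open import Data.Nat.Properties hiding (_≟_; _≤?_)
open import Data.Nat.Tactic.RingSolver using (solve-∀)
open import Algebra.Properties.CommutativeSemigroup +-commutativeSemigroup using (x∙yz≈y∙xz)
open import Data.Product using (Σ; ∃; _×_; _,_; proj₁; proj₂; map₁; map₂)
open import Data.Sum using (inj₁; inj₂)
open import Data.Unit using (⊤; tt)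
open import Data.Vec using (Vec; []; _∷_; lookup; insertAt; toList)
import Data.Vec.Properties as VecProps
open import Function using (_∘_)
open import Function.Bundles using (_⇔_; mk⇔; Equivalence)
open import Relation.Binary.Bundles using (DecTotalOrder)
import Relation.Binary.Construct.NonStrictToStrict as ToStrict
open import Relation.Binary.PropositionalEquality
open import Relation.Binary.Structures using (IsDecTotalOrder)
open import Relation.Nullary using (yes; no; does; ¬?)
open import Relation.Nullary.Decidable using (does-⇔)

-- Ceiling logarithm

clogGo-sound : ∀ a b f k → a ≤ b * 2 ^ (k + f) → a ≤ b * 2 ^ clogGo a b f k
clogGo-sound a b zero    k h rewrite +-identityʳ k = h
clogGo-sound a b (suc f) k h with a ≤ᵇ b * 2 ^ k in eq
... | true  = ≤ᵇ⇒≤ a (b * 2 ^ k) (subst T (sym eq) _)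
... | false = clogGo-sound a b f (suc k) (subst (λ z → a ≤ b * 2 ^ z) (+-suc k f) h)

clogGo-least : ∀ a b f k l → k ≤ l → a ≤ b * 2 ^ l → clogGo a b f k ≤ l
clogGo-least a b zero    k l k≤l h = k≤l
clogGo-least a b (suc f) k l k≤l h with a ≤ᵇ b * 2 ^ k in eq | m≤n⇒m<n∨m≡n k≤l
... | true  | _          = k≤l
... | false | inj₁ k<l   = clogGo-least a b f (suc k) l k<l h
... | false | inj₂ refl  = ⊥-elim (subst T eq (≤⇒≤ᵇ h))

n<2^n : ∀ n → n < 2 ^ n
n<2^n zero    = s≤s z≤n
n<2^n (suc n) = subst (suc (suc n) ≤_) (cong (2 ^ n +_) (sym (+-identityʳ (2 ^ n))))
  (+-mono-≤ (m^n>0 2 n) (n<2^n n))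

≤*2^suc : ∀ a {b} → 1 ≤ b → a ≤ b * 2 ^ suc a
≤*2^suc a {b} 1≤b = begin
  a             ≤⟨ ≤-trans (n≤1+n a) (<⇒≤ (n<2^n (suc a))) ⟩
  2 ^ suc a     ≡⟨ *-identityˡ (2 ^ suc a) ⟨
  1 * 2 ^ suc a ≤⟨ *-monoˡ-≤ (2 ^ suc a) 1≤b ⟩
  b * 2 ^ suc a ∎
  where open ≤-Reasoning

clog-sound : ∀ a {b} → 1 ≤ b → a ≤ b * 2 ^ clog a b
clog-sound a {b} 1≤b = clogGo-sound a b (suc a) 0 (≤*2^suc a 1≤b)

clog-least : ∀ a b {l} → a ≤ b * 2 ^ l → clog a b ≤ l
clog-least a b h = clogGo-least a b (suc a) 0 _ z≤n h

clog≤suc : ∀ a {b} → 1 ≤ b → clog a b ≤ suc a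
clog≤suc a {b} 1≤b = clog-least a b (≤*2^suc a 1≤b)

clog-antitone : ∀ a {b b′} → 1 ≤ b → b ≤ b′ → clog a b′ ≤ clog a b
clog-antitone a {b} {b′} 1≤b b≤b′ =
  clog-least a b′ (≤-trans (clog-sound a 1≤b) (*-monoˡ-≤ (2 ^ clog a b) b≤b′))

-- Codewords

-- u ≺ w: the nodes at paths u and w are incomparable, u to the left of w.
data _≺_ : List Bool → List Bool → Set where
  here  : ∀ {u w} → (false ∷ u) ≺ (true ∷ w)
  there : ∀ {b u w} → u ≺ w → (b ∷ u) ≺ (b ∷ w)

≺-take⁻ : ∀ l {u w} → take l u ≺ take l w → u ≺ w
≺-take⁻ (suc l) {_ ∷ _} {_ ∷ _} here      = here
≺-take⁻ (suc l) {_ ∷ _} {_ ∷ _} (there p) = there (≺-take⁻ l p)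

bit : Bool → ℕ
bit b = if b then 1 else 0

value : List Bool → ℕ
value []      = 0
value (b ∷ u) = bit b * 2 ^ length u + value u

value<2^length : ∀ u → value u < 2 ^ length u
value<2^length []          = s≤s z≤n
value<2^length (false ∷ u) = ≤-trans (value<2^length u) (m≤m+n (2 ^ length u) _)
value<2^length (true ∷ u)  = begin-strict
  1 * 2 ^ length u + value u        <⟨ +-monoʳ-< (1 * 2 ^ length u) (value<2^length u) ⟩
  1 * 2 ^ length u + 2 ^ length u   ≡⟨ cong (_+ 2 ^ length u) (*-identityˡ (2 ^ length u)) ⟩
  2 ^ length u + 2 ^ length u       ≡⟨ cong (2 ^ length u +_) (+-identityʳ (2 ^ length u)) ⟨
  2 ^ suc (length u)                ∎
  where open ≤-Reasoning

value-<⇒≺ : ∀ u w → length u ≡ length w → value u < value w → u ≺ w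
value-<⇒≺ (false ∷ u) (true  ∷ w) _  _ = here
value-<⇒≺ (false ∷ u) (false ∷ w) eq lt = there (value-<⇒≺ u w (suc-injective eq) lt)
value-<⇒≺ (true  ∷ u) (true  ∷ w) eq lt = there (value-<⇒≺ u w |u|≡|w|
  (+-cancelˡ-< (1 * 2 ^ length w) _ _ (subst (λ l → 1 * 2 ^ l + value u < 1 * 2 ^ length w + value w) |u|≡|w| lt)))
  where
  |u|≡|w| : length u ≡ length w
  |u|≡|w| = suc-injective eq
value-<⇒≺ (true  ∷ u) (false ∷ w) eq lt = ⊥-elim (<-asym lt (begin-strict
  value w                     <⟨ value<2^length w ⟩
  2 ^ length w                ≡⟨ cong (2 ^_) (suc-injective eq) ⟨
  2 ^ length u                ≡⟨ *-identityˡ (2 ^ length u) ⟨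
  1 * 2 ^ length u            ≤⟨ m≤m+n (1 * 2 ^ length u) (value u) ⟩
  1 * 2 ^ length u + value u  ∎))
  where open ≤-Reasoning

length-bits : ∀ l a → length (bits l a) ≡ l
length-bits zero    a = refl
length-bits (suc l) a = cong suc (length-bits l a)

bit-%2+2*⌊/2⌋ : ∀ a → bit (a % 2 ≡ᵇ 1) + 2 * ⌊ a /2⌋ ≡ a
bit-%2+2*⌊/2⌋ zero          = refl
bit-%2+2*⌊/2⌋ (suc zero)    = refl
bit-%2+2*⌊/2⌋ (suc (suc a)) =
  trans (regroup (bit (a % 2 ≡ᵇ 1)) ⌊ a /2⌋) (cong (2 +_) (bit-%2+2*⌊/2⌋ a))
  where
  regroup : ∀ b h → b + 2 * (1 + h) ≡ 2 + (b + 2 * h)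
  regroup = solve-∀

value-bits+shiftR : ∀ l a → value (bits l a) + 2 ^ l * shiftR l a ≡ a
value-bits+shiftR zero    a = +-identityʳ a
value-bits+shiftR (suc l) a = begin
  bit b * 2 ^ length (bits l a) + value (bits l a) + 2 ^ suc l * ⌊ y /2⌋
    ≡⟨ cong (λ L → bit b * 2 ^ L + value (bits l a) + 2 ^ suc l * ⌊ y /2⌋) (length-bits l a) ⟩
  bit b * 2 ^ l + value (bits l a) + 2 * 2 ^ l * ⌊ y /2⌋
    ≡⟨ regroup (bit b) (2 ^ l) (value (bits l a)) ⌊ y /2⌋ ⟩
  value (bits l a) + 2 ^ l * (bit b + 2 * ⌊ y /2⌋)
    ≡⟨ cong (λ z → value (bits l a) + 2 ^ l * z) (bit-%2+2*⌊/2⌋ y) ⟩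
  value (bits l a) + 2 ^ l * y
    ≡⟨ value-bits+shiftR l a ⟩
  a ∎
  where
  open ≡-Reasoning
  y : ℕ
  y = shiftR l a
  b : Bool
  b = y % 2 ≡ᵇ 1
  regroup : ∀ x p v z → x * p + v + 2 * p * z ≡ v + p * (x + 2 * z)
  regroup = solve-∀

value-bits : ∀ l a → a < 2 ^ l → value (bits l a) ≡ a
value-bits l a a<2^l with shiftR l a | value-bits+shiftR l a
... | zero  | eq = trans (sym (+-identityʳ _)) (subst (λ z → value (bits l a) + z ≡ a) (*-zeroʳ (2 ^ l)) eq)
... | suc s | eq = ⊥-elim (<⇒≱ a<2^l (begin
  2 ^ l                                   ≤⟨ m≤m*n (2 ^ l) (suc s) ⟩
  2 ^ l * suc s                           ≤⟨ m≤n+m _ (value (bits l a)) ⟩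
  value (bits l a) + 2 ^ l * suc s        ≡⟨ eq ⟩
  a                                       ∎))
  where open ≤-Reasoning

bits-≺ : ∀ l {a b} → a < b → b < 2 ^ l → bits l a ≺ bits l b
bits-≺ l {a} {b} a<b b<2^l = value-<⇒≺ _ _ (trans (length-bits l a) (sym (length-bits l b)))
  (subst₂ _<_ (sym (value-bits l a (<-trans a<b b<2^l))) (sym (value-bits l b b<2^l)) a<b)

⌊n/2⌋≡n/2 : ∀ n → ⌊ n /2⌋ ≡ n / 2
⌊n/2⌋≡n/2 zero          = refl
⌊n/2⌋≡n/2 (suc zero)    = refl
⌊n/2⌋≡n/2 (suc (suc n)) = trans (cong suc (⌊n/2⌋≡n/2 n)) (sym (m/n≡1+[m∸n]/n (s≤s (s≤s (z≤n {n})))))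

shiftR≡/2^ : ∀ d x → shiftR d x ≡ (x / 2 ^ d) {{m^n≢0 2 d}}
shiftR≡/2^ zero    x = sym (n/1≡n x)
shiftR≡/2^ (suc d) x = begin
  ⌊ shiftR d x /2⌋    ≡⟨ ⌊n/2⌋≡n/2 (shiftR d x) ⟩
  shiftR d x / 2      ≡⟨ /-congˡ (shiftR≡/2^ d x) ⟩
  x / 2 ^ d / 2       ≡⟨ m/n/o≡m/[n*o] x (2 ^ d) 2 ⟩
  x / (2 ^ d * 2)     ≡⟨ /-congʳ (*-comm (2 ^ d) 2) ⟩
  x / 2 ^ suc d       ∎
  where
  open ≡-Reasoning
  instance
    2^d≢0 : NonZero (2 ^ d)
    2^d≢0 = m^n≢0 2 d
    2^d*2≢0 : NonZero (2 ^ d * 2)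
    2^d*2≢0 = m*n≢0 (2 ^ d) 2
    2^[1+d]≢0 : NonZero (2 ^ suc d)
    2^[1+d]≢0 = m^n≢0 2 (suc d)

shiftR-+ : ∀ l d a → shiftR l (shiftR d a) ≡ shiftR (l + d) a
shiftR-+ zero    d a = refl
shiftR-+ (suc l) d a = cong ⌊_/2⌋ (shiftR-+ l d a)

take-bits : ∀ l d a → take l (bits (l + d) a) ≡ bits l (shiftR d a)
take-bits zero    d a = refl
take-bits (suc l) d a = cong₂ _∷_ (cong (λ z → z % 2 ≡ᵇ 1) (sym (shiftR-+ l d a))) (take-bits l d a)

take-bits-scaled : ∀ N D {{_ : NonZero D}} {l L} → l ≤ L →
                   take l (bits L (N * 2 ^ L / D)) ≡ bits l (N * 2 ^ l / D)
take-bits-scaled N D {l = l} {L} l≤L = begin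
  take l (bits L (N * 2 ^ L / D))             ≡⟨ cong (λ k → take l (bits k (N * 2 ^ k / D))) L≡l+d ⟩
  take l (bits (l + d) (N * 2 ^ (l + d) / D)) ≡⟨ take-bits l d _ ⟩
  bits l (shiftR d (N * 2 ^ (l + d) / D))     ≡⟨ cong (bits l) shifted ⟩
  bits l (N * 2 ^ l / D)                      ∎
  where
  open ≡-Reasoning
  d : ℕ
  d = L ∸ l
  instance
    2^d≢0 : NonZero (2 ^ d)
    2^d≢0 = m^n≢0 2 d
    D*2^d≢0 : NonZero (D * 2 ^ d)
    D*2^d≢0 = m*n≢0 D (2 ^ d)
  L≡l+d : L ≡ l + d
  L≡l+d = sym (m+[n∸m]≡n l≤L)
  shifted : shiftR d (N * 2 ^ (l + d) / D) ≡ N * 2 ^ l / D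
  shifted = begin
    shiftR d (N * 2 ^ (l + d) / D)     ≡⟨ shiftR≡/2^ d _ ⟩
    N * 2 ^ (l + d) / D / 2 ^ d        ≡⟨ m/n/o≡m/[n*o] _ D (2 ^ d) ⟩
    N * 2 ^ (l + d) / (D * 2 ^ d)      ≡⟨ /-congˡ (trans (cong (N *_) (^-distribˡ-+-* 2 l d)) (sym (*-assoc N _ _))) ⟩
    N * 2 ^ l * 2 ^ d / (D * 2 ^ d)    ≡⟨ m*n/o*n≡m/o (N * 2 ^ l) (2 ^ d) D ⟩
    N * 2 ^ l / D                      ∎

/-<-+divisor : ∀ {x y} D {{_ : NonZero D}} → x + D ≤ y → x / D < y / D
/-<-+divisor {x} {y} D x+D≤y = begin-strict
  x / D          <⟨ m<m+n (x / D) (s≤s z≤n) ⟩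
  x / D + 1      ≡⟨ cong (x / D +_) (n/n≡1 D) ⟨
  x / D + D / D  ≡⟨ +-distrib-/-∣ʳ x ∣-refl ⟨
  (x + D) / D    ≤⟨ /-monoˡ-≤ D x+D≤y ⟩
  y / D          ∎
  where open ≤-Reasoning

bits-scaled-≺ : ∀ l N N′ D {{_ : NonZero D}} → N′ < D → N * 2 ^ l + D ≤ N′ * 2 ^ l →
                bits l (N * 2 ^ l / D) ≺ bits l (N′ * 2 ^ l / D)
bits-scaled-≺ l N N′ D N′<D gap = bits-≺ l (/-<-+divisor D gap)
  (m<n*o⇒m/o<n (subst (N′ * 2 ^ l <_) (*-comm D (2 ^ l)) (*-monoˡ-< (2 ^ l) {{m^n≢0 2 l}} N′<D)))

codeLength : ℕ → ℕ → ℕ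
codeLength n c = suc (clog (suc n) c)

-- Definitionally the σ that Seq.codesGo assigns to an element with C_j = C and c_j = c, for i = suc n.
codeword : ℕ → ℕ → ℕ → List Bool
codeword n C c = bits (codeLength n c) ((2 * C + c) * 2 ^ codeLength n c / (2 * suc n))

2*suc≤*2^codeLength : ∀ n {c l} → 1 ≤ c → codeLength n c ≤ l → 2 * suc n ≤ c * 2 ^ l
2*suc≤*2^codeLength n {c} {l} 1≤c L≤l = begin
  2 * suc n                  ≤⟨ *-monoʳ-≤ 2 (clog-sound (suc n) 1≤c) ⟩
  2 * (c * 2 ^ K)            ≡⟨ x*[y*z]≡y*[x*z] 2 c (2 ^ K) ⟩
  c * 2 ^ suc K              ≤⟨ *-monoʳ-≤ c (^-monoʳ-≤ 2 L≤l) ⟩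
  c * 2 ^ l                  ∎
  where
  open ≤-Reasoning
  K : ℕ
  K = clog (suc n) c
  x*[y*z]≡y*[x*z] : ∀ x y z → x * (y * z) ≡ y * (x * z)
  x*[y*z]≡y*[x*z] = solve-∀

-- Truncated to length l the codewords are the l-bit floors of f·2^l < f′·2^l, and these differ
-- because f′ − f ≥ (c + c′)/(2i) ≥ 2^(−l).
codeword-≺-upTo : ∀ n {C c C′ c′} l → l ≤ codeLength n c → l ≤ codeLength n c′ →
                  C + c ≤ C′ → C′ + c′ ≤ suc n → 1 ≤ c′ → 2 * suc n ≤ (c + c′) * 2 ^ l →
                  codeword n C c ≺ codeword n C′ c′
codeword-≺-upTo n {C} {c} {C′} {c′} l l≤L l≤L′ C+c≤C′ C′+c′≤1+n 1≤c′ D≤[c+c′]2^l =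
  ≺-take⁻ l (subst₂ _≺_ (sym (take-bits-scaled N D l≤L)) (sym (take-bits-scaled N′ D l≤L′))
    (bits-scaled-≺ l N N′ D N′<D gap))
  where
  open ≤-Reasoning
  D N N′ : ℕ
  D  = 2 * suc n
  N  = 2 * C + c
  N′ = 2 * C′ + c′
  N′<D : N′ < D
  N′<D = begin-strict
    2 * C′ + c′        <⟨ +-monoʳ-< (2 * C′) (m<m+n c′ 1≤c′) ⟩
    2 * C′ + (c′ + c′) ≡⟨ cong (λ z → 2 * C′ + (c′ + z)) (+-identityʳ c′) ⟨
    2 * C′ + 2 * c′    ≡⟨ *-distribˡ-+ 2 C′ c′ ⟨
    2 * (C′ + c′)      ≤⟨ *-monoʳ-≤ 2 C′+c′≤1+n ⟩
    D                  ∎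
  gap : N * 2 ^ l + D ≤ N′ * 2 ^ l
  gap = begin
    N * 2 ^ l + D                  ≤⟨ +-monoʳ-≤ (N * 2 ^ l) D≤[c+c′]2^l ⟩
    N * 2 ^ l + (c + c′) * 2 ^ l   ≡⟨ *-distribʳ-+ (2 ^ l) N (c + c′) ⟨
    (N + (c + c′)) * 2 ^ l         ≡⟨ cong (_* 2 ^ l) (regroup C c c′) ⟩
    (2 * (C + c) + c′) * 2 ^ l     ≤⟨ *-monoˡ-≤ (2 ^ l) (+-monoˡ-≤ c′ (*-monoʳ-≤ 2 C+c≤C′)) ⟩
    N′ * 2 ^ l                     ∎
    where
    regroup : ∀ x y z → 2 * x + y + (y + z) ≡ 2 * (x + y) + z
    regroup = solve-∀

codeword-≺ : ∀ n {C c C′ c′} → 1 ≤ c → 1 ≤ c′ → C + c ≤ C′ → C′ + c′ ≤ suc n →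
             codeword n C c ≺ codeword n C′ c′
codeword-≺ n {C} {c} {C′} {c′} 1≤c 1≤c′ C+c≤C′ C′+c′≤1+n
  with ≤-total (codeLength n c) (codeLength n c′)
... | inj₁ L≤L′ = codeword-≺-upTo n {C} {c} {C′} {c′} _ ≤-refl L≤L′ C+c≤C′ C′+c′≤1+n 1≤c′
  (≤-trans (2*suc≤*2^codeLength n 1≤c ≤-refl) (*-monoˡ-≤ _ (m≤m+n c c′)))
... | inj₂ L′≤L = codeword-≺-upTo n {C} {c} {C′} {c′} _ L′≤L ≤-refl C+c≤C′ C′+c′≤1+n 1≤c′
  (≤-trans (2*suc≤*2^codeLength n 1≤c′ ≤-refl) (*-monoˡ-≤ _ (m≤n+m c′ c)))

-- Tries

private variable
  D D′ P P′ : Set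

Sorted : List (List Bool × D) → Set
Sorted = AllPairs (λ e e′ → proj₁ e ≺ proj₁ e′)

Bounded : ℕ → List (List Bool × D) → Set
Bounded f = All (λ e → length (proj₁ e) ≤ f)

tag : Bool → List (List Bool × D) → List (List Bool × D)
tag b = map (map₁ (b ∷_))

paths : BTree D P → List (List Bool × D)
paths (leaf d)     = ([] , d) ∷ []
paths (onlyL t)    = tag false (paths t)
paths (onlyR t)    = tag true (paths t)
paths (both l _ r) = tag false (paths l) ++ tag true (paths r)

hasEmpty-≻ : ∀ {u} (xs : List (List Bool × D)) → All (λ e → u ≺ proj₁ e) xs → hasEmpty xs ≡ false
hasEmpty-≻ []       []             = refl
hasEmpty-≻ (_ ∷ xs) (here    ∷ ps) = hasEmpty-≻ xs ps
hasEmpty-≻ (_ ∷ xs) (there _ ∷ ps) = hasEmpty-≻ xs ps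

branch-≻ : ∀ b {u} (xs : List (List Bool × D)) →
           All (λ e → (b ∷ u) ≺ proj₁ e) xs → All (λ e → u ≺ proj₁ e) (branch b xs)
branch-≻ b     []                      []             = []
branch-≻ true  ((true  ∷ w , d) ∷ xs)  (there p ∷ ps) = p ∷ branch-≻ true xs ps
branch-≻ true  ((false ∷ w , d) ∷ xs)  (_       ∷ ps) = branch-≻ true xs ps
branch-≻ false ((false ∷ w , d) ∷ xs)  (there p ∷ ps) = p ∷ branch-≻ false xs ps
branch-≻ false ((true  ∷ w , d) ∷ xs)  (_       ∷ ps) = branch-≻ false xs ps

branch-sorted : ∀ b (xs : List (List Bool × D)) → Sorted xs → Sorted (branch b xs)
branch-sorted b     []                     []       = []
branch-sorted b     (([] , d) ∷ xs)        (_ ∷ ps) = branch-sorted b xs ps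
branch-sorted true  ((true  ∷ w , d) ∷ xs) (p ∷ ps) = branch-≻ true xs p ∷ branch-sorted true xs ps
branch-sorted true  ((false ∷ w , d) ∷ xs) (_ ∷ ps) = branch-sorted true xs ps
branch-sorted false ((false ∷ w , d) ∷ xs) (p ∷ ps) = branch-≻ false xs p ∷ branch-sorted false xs ps
branch-sorted false ((true  ∷ w , d) ∷ xs) (_ ∷ ps) = branch-sorted false xs ps

branch-bounded : ∀ b {f} (xs : List (List Bool × D)) → Bounded (suc f) xs → Bounded f (branch b xs)
branch-bounded b     []                     []           = []
branch-bounded b     (([] , d) ∷ xs)        (_ ∷ ps)     = branch-bounded b xs ps
branch-bounded true  ((true  ∷ w , d) ∷ xs) (s≤s p ∷ ps) = p ∷ branch-bounded true xs ps
branch-bounded true  ((false ∷ w , d) ∷ xs) (_ ∷ ps)     = branch-bounded true xs ps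
branch-bounded false ((false ∷ w , d) ∷ xs) (s≤s p ∷ ps) = p ∷ branch-bounded false xs ps
branch-bounded false ((true  ∷ w , d) ∷ xs) (_ ∷ ps)     = branch-bounded false xs ps

branch-false-≻true : ∀ {u} (xs : List (List Bool × D)) →
                     All (λ e → (true ∷ u) ≺ proj₁ e) xs → branch false xs ≡ []
branch-false-≻true []                    []             = refl
branch-false-≻true ((true ∷ w , d) ∷ xs) (there _ ∷ ps) = branch-false-≻true xs ps

split-branches : (xs : List (List Bool × D)) → Sorted xs → hasEmpty xs ≡ false →
                 xs ≡ tag false (branch false xs) ++ tag true (branch true xs)
split-branches []                     []       _ = refl
split-branches ((false ∷ w , d) ∷ xs) (_ ∷ ps) h = cong (_ ∷_) (split-branches xs ps h)
split-branches ((true  ∷ w , d) ∷ xs) (p ∷ ps) h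
  rewrite branch-false-≻true xs p = cong (_ ∷_) (trans (split-branches xs ps h)
    (cong (λ ys → tag false ys ++ tag true (branch true xs)) (branch-false-≻true xs p)))

Codewords : ℕ → List (List Bool × D) → Set
Codewords f xs = Sorted xs × Bounded f xs

branch-codewords : ∀ b {f} (xs : List (List Bool × D)) → Codewords (suc f) xs → Codewords f (branch b xs)
branch-codewords b xs (sorted , bounded) = branch-sorted b xs sorted , branch-bounded b xs bounded

trie-paths : (key : D → P) (f : ℕ) (e : List Bool × D) (es : List (List Bool × D)) → Codewords f (e ∷ es) →
             ∃ λ t → trie key f (e ∷ es) ≡ just t × paths t ≡ e ∷ es
trie-paths key f       ([] , d)    []      _                     = leaf d , refl , refl
trie-paths key f       ([] , d)    (_ ∷ _) ((() ∷ _) ∷ _ , _)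
trie-paths key zero    (_ ∷ _ , d) es      (_ , () ∷ _)
trie-paths key (suc f) (b ∷ w , d) es      cw@(sorted@(p ∷ _) , _)
  rewrite hasEmpty-≻ es p
  with branch false ((b ∷ w , d) ∷ es) in eqL | branch true ((b ∷ w , d) ∷ es) in eqR
     | split-branches ((b ∷ w , d) ∷ es) sorted (hasEmpty-≻ es p)
... | []     | []     | ()
... | L ∷ Ls | []     | split
  with trie-paths key f L Ls (subst (Codewords f) eqL (branch-codewords false _ cw))
...   | l , eq , pl rewrite eq =
  onlyL l , refl , trans (cong (tag false) pl) (sym (trans split (++-identityʳ _)))
trie-paths key (suc f) (b ∷ w , d) es cw@(sorted@(p ∷ _) , _) | []     | R ∷ Rs | split
  with trie-paths key f R Rs (subst (Codewords f) eqR (branch-codewords true _ cw))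
...   | r , eq , pr rewrite eq =
  onlyR r , refl , trans (cong (tag true) pr) (sym split)
trie-paths key (suc f) (b ∷ w , d) es cw@(sorted@(p ∷ _) , _) | L ∷ Ls | R ∷ Rs | split
  with trie-paths key f L Ls (subst (Codewords f) eqL (branch-codewords false _ cw))
     | trie-paths key f R Rs (subst (Codewords f) eqR (branch-codewords true _ cw))
...   | l , eql , pl | r , eqr , pr rewrite eql | eqr =
  both l (key (rightmost l)) r , refl , trans (cong₂ (λ u v → tag false u ++ tag true v) pl pr) (sym split)

mapTree-∘ : ∀ {D″ P″ : Set} (f : D′ → D″) (g : P′ → P″) (f′ : D → D′) (g′ : P → P′)
            (t : BTree D P) →
            mapTree f g (mapTree f′ g′ t) ≡ mapTree (f ∘ f′) (g ∘ g′) t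
mapTree-∘ f g f′ g′ (leaf d)     = refl
mapTree-∘ f g f′ g′ (onlyL t)    = cong onlyL (mapTree-∘ f g f′ g′ t)
mapTree-∘ f g f′ g′ (onlyR t)    = cong onlyR (mapTree-∘ f g f′ g′ t)
mapTree-∘ f g f′ g′ (both l p r) =
  cong₂ (λ l′ r′ → both l′ (g (g′ p)) r′) (mapTree-∘ f g f′ g′ l) (mapTree-∘ f g f′ g′ r)

module _ (key : D → P) (key′ : D′ → P′) (h : D → D′) (g : P → P′)
         (key′∘h≗g∘key : ∀ d → key′ (h d) ≡ g (key d)) where

  branch-map : ∀ b xs → branch b (map (map₂ h) xs) ≡ map (map₂ h) (branch b xs)
  branch-map b     []                     = refl
  branch-map b     (([] , d) ∷ xs)        = branch-map b xs
  branch-map true  ((true  ∷ w , d) ∷ xs) = cong ((w , h d) ∷_) (branch-map true xs)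
  branch-map true  ((false ∷ w , d) ∷ xs) = branch-map true xs
  branch-map false ((false ∷ w , d) ∷ xs) = cong ((w , h d) ∷_) (branch-map false xs)
  branch-map false ((true  ∷ w , d) ∷ xs) = branch-map false xs

  hasEmpty-map : ∀ xs → hasEmpty (map (map₂ h) xs) ≡ hasEmpty xs
  hasEmpty-map []                = refl
  hasEmpty-map (([] , d) ∷ xs)    = refl
  hasEmpty-map ((_ ∷ _ , d) ∷ xs) = hasEmpty-map xs

  rightmost-mapTree : ∀ t → rightmost (mapTree h g t) ≡ h (rightmost t)
  rightmost-mapTree (leaf d)     = refl
  rightmost-mapTree (onlyL t)    = rightmost-mapTree t
  rightmost-mapTree (onlyR t)    = rightmost-mapTree t
  rightmost-mapTree (both _ _ r) = rightmost-mapTree r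

  trie-map : ∀ f xs → trie key′ f (map (map₂ h) xs) ≡ Maybe.map (mapTree h g) (trie key f xs)
  trie-map f       []                    = refl
  trie-map f       (([] , d) ∷ [])       = refl
  trie-map zero    (([] , d) ∷ _ ∷ _)    = refl
  trie-map zero    ((_ ∷ _ , d) ∷ _)     = refl
  trie-map (suc f) (([] , d) ∷ _ ∷ _)    = refl
  trie-map (suc f) xs@((_ ∷ _ , _) ∷ es) rewrite hasEmpty-map es with hasEmpty es
  ... | true  = refl
  ... | false rewrite branch-map false xs | branch-map true xs
    with branch false xs | branch true xs
  ... | []     | []     = refl
  ... | L ∷ Ls | []     rewrite trie-map f (L ∷ Ls) with trie key f (L ∷ Ls)
  ...   | just _  = refl
  ...   | nothing = refl
  trie-map (suc f) xs@((_ ∷ _ , _) ∷ es) | false | [] | R ∷ Rs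
    rewrite trie-map f (R ∷ Rs) with trie key f (R ∷ Rs)
  ...   | just _  = refl
  ...   | nothing = refl
  trie-map (suc f) xs@((_ ∷ _ , _) ∷ es) | false | L ∷ Ls | R ∷ Rs
    rewrite trie-map f (L ∷ Ls) | trie-map f (R ∷ Rs) with trie key f (L ∷ Ls) | trie key f (R ∷ Rs)
  ...   | just l  | just r  =
    cong (λ p → just (both (mapTree h g l) p (mapTree h g r)))
         (trans (cong key′ (rightmost-mapTree l)) (key′∘h≗g∘key (rightmost l)))
  ...   | just _  | nothing = refl
  ...   | nothing | _       = refl

-- Codes of a sequence

module Codes {A : Set} {_≤A_ : A → A → Set} (O : IsDecTotalOrder _≡_ _≤A_) where
  open Seq O
  open IsDecTotalOrder O using (_≟_; _≤?_)
  open import Data.List.Relation.Unary.Unique.DecPropositional _≟_ using (Unique)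
  open import Data.List.Relation.Unary.Unique.DecPropositional.Properties _≟_ using (deduplicate-!)

  ∈⇒1≤count# : ∀ {x xs} → x ∈ xs → 1 ≤ count# x xs
  ∈⇒1≤count# {x} {y ∷ xs} x∈ with y ≟ x | x∈
  ... | yes _   | _          = s≤s z≤n
  ... | no y≢x  | here x≡y   = ⊥-elim (y≢x (sym x≡y))
  ... | no _    | there x∈xs = ∈⇒1≤count# x∈xs

  count#-∉ : ∀ {x} xs → All (x ≢_) xs → count# x xs ≡ 0
  count#-∉ []       []           = refl
  count#-∉ {x} (y ∷ xs) (x≢y ∷ ps) with y ≟ x
  ... | yes y≡x = ⊥-elim (x≢y (sym y≡x))
  ... | no _    = count#-∉ xs ps

  count#≤1 : ∀ {x as} → Unique as → count# x as ≤ 1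
  count#≤1 {as = []}   []          = z≤n
  count#≤1 {x} {a ∷ as} (a∉as ∷ u) with a ≟ x
  ... | yes refl = s≤s (≤-reflexive (count#-∉ as a∉as))
  ... | no _     = count#≤1 u

  count#-insert : ∀ x a l → count# x (insert a l) ≡ count# x (a ∷ l)
  count#-insert x a []      = refl
  count#-insert x a (y ∷ l) with does (a ≤? y)
  ... | true  = refl
  ... | false with count#-insert x a l
  ...   | ih with y ≟ x | a ≟ x
  ...     | yes _ | yes _ = cong suc ih
  ...     | yes _ | no _  = cong suc ih
  ...     | no _  | yes _ = ih
  ...     | no _  | no _  = ih

  count#-isort : ∀ x l → count# x (isort l) ≡ count# x l
  count#-isort x []      = refl
  count#-isort x (a ∷ l) with count#-insert x a (isort l)
  ... | eq with a ≟ x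
  ...   | yes _ = trans eq (cong suc (count#-isort x l))
  ...   | no _  = trans eq (count#-isort x l)

  count#-distinctSorted≤1 : ∀ xs x → count# x (distinctSorted xs) ≤ 1
  count#-distinctSorted≤1 xs x =
    ≤-trans (≤-reflexive (count#-isort x (deduplicate _≟_ xs))) (count#≤1 (deduplicate-! xs))

  All-insert : ∀ {P : A → Set} {a l} → P a → All P l → All P (insert a l)
  All-insert {l = []}    pa []         = pa ∷ []
  All-insert {a = a} {y ∷ l} pa (py ∷ ps) with does (a ≤? y)
  ... | true  = pa ∷ py ∷ ps
  ... | false = py ∷ All-insert pa ps

  All-isort : ∀ {P : A → Set} {l} → All P l → All P (isort l)
  All-isort []       = []
  All-isort (p ∷ ps) = All-insert p (All-isort ps)

  distinctSorted⊆ : ∀ xs → All (_∈ xs) (distinctSorted xs)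
  distinctSorted⊆ xs = All-isort (deduplicate⁺ _≟_ (All.tabulate (λ x∈xs → x∈xs)))

  insert≢[] : ∀ a l → insert a l ≢ []
  insert≢[] a []      ()
  insert≢[] a (y ∷ l) with does (a ≤? y)
  ... | true  = λ ()
  ... | false = λ ()

  isort≢[] : ∀ l → l ≢ [] → isort l ≢ []
  isort≢[] []      l≢[] = l≢[]
  isort≢[] (a ∷ l) _    = insert≢[] a (isort l)

  countSum : List A → List A → ℕ
  countSum as xs = sum (map (λ a → count# a xs) as)

  countSum-∷ : ∀ as y ys → countSum as (y ∷ ys) ≡ count# y as + countSum as ys
  countSum-∷ []       y ys = refl
  countSum-∷ (a ∷ as) y ys with y ≟ a | a ≟ y
  ... | yes _   | yes _   = cong suc (trans (cong (count# a ys +_) (countSum-∷ as y ys))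
                                            (x∙yz≈y∙xz (count# a ys) (count# y as) (countSum as ys)))
  ... | yes y≡a | no a≢y  = ⊥-elim (a≢y (sym y≡a))
  ... | no y≢a  | yes a≡y = ⊥-elim (y≢a (sym a≡y))
  ... | no _    | no _    = trans (cong (count# a ys +_) (countSum-∷ as y ys))
                                  (x∙yz≈y∙xz (count# a ys) (count# y as) (countSum as ys))

  countSum-[] : ∀ as → countSum as [] ≡ 0
  countSum-[] []       = refl
  countSum-[] (_ ∷ as) = countSum-[] as

  countSum≤length : ∀ as → (∀ x → count# x as ≤ 1) → ∀ xs → countSum as xs ≤ length xs
  countSum≤length as ≤1 []       = ≤-reflexive (countSum-[] as)
  countSum≤length as ≤1 (y ∷ ys) =
    ≤-trans (≤-reflexive (countSum-∷ as y ys)) (+-mono-≤ (≤1 y) (countSum≤length as ≤1 ys))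

  codesGo-≻ : ∀ n xs {C c} C₀ as → 1 ≤ c → C + c ≤ C₀ → All (_∈ xs) as → C₀ + countSum as xs ≤ suc n →
              All (λ e → codeword n C c ≺ proj₁ e) (codesGo n xs C₀ as)
  codesGo-≻ n xs C₀ []       _   _      []           _     = []
  codesGo-≻ n xs C₀ (a ∷ as) 1≤c C+c≤C₀ (a∈xs ∷ as⊆) bound =
    codeword-≺ n 1≤c (∈⇒1≤count# a∈xs) C+c≤C₀ (≤-trans (+-monoʳ-≤ C₀ (m≤m+n _ _)) bound)
    ∷ codesGo-≻ n xs (C₀ + count# a xs) as 1≤c (≤-trans C+c≤C₀ (m≤m+n _ _)) as⊆
                (≤-trans (≤-reflexive (+-assoc C₀ _ _)) bound)

  codesGo-sorted : ∀ n xs C as → All (_∈ xs) as → C + countSum as xs ≤ suc n → Sorted (codesGo n xs C as)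
  codesGo-sorted n xs C []       []           _     = []
  codesGo-sorted n xs C (a ∷ as) (a∈xs ∷ as⊆) bound =
    codesGo-≻ n xs (C + count# a xs) as (∈⇒1≤count# a∈xs) ≤-refl as⊆ bound′
    ∷ codesGo-sorted n xs (C + count# a xs) as as⊆ bound′
    where
    bound′ : C + count# a xs + countSum as xs ≤ suc n
    bound′ = ≤-trans (≤-reflexive (+-assoc C _ _)) bound

  codesGo-lengths : ∀ n xs C as →
    All (λ e → length (proj₁ e) ≡ codeLength n (count# (proj₁ (proj₂ e)) xs)) (codesGo n xs C as)
  codesGo-lengths n xs C []       = []
  codesGo-lengths n xs C (a ∷ as) = length-bits _ _ ∷ codesGo-lengths n xs _ as

  codesGo-bounded : ∀ n xs C as → All (_∈ xs) as → Bounded (3 + n) (codesGo n xs C as)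
  codesGo-bounded n xs C []       []           = []
  codesGo-bounded n xs C (a ∷ as) (a∈xs ∷ as⊆) =
    ≤-trans (≤-reflexive (length-bits _ _)) (s≤s (clog≤suc (suc n) (∈⇒1≤count# a∈xs)))
    ∷ codesGo-bounded n xs _ as as⊆

  codesGo-ranks : ∀ n xs C as → map (λ e → proj₁ (proj₂ e)) (codesGo n xs C as) ≡ as
  codesGo-ranks n xs C []       = refl
  codesGo-ranks n xs C (a ∷ as) = cong (a ∷_) (codesGo-ranks n xs _ as)

  codeTrie : ∀ n xs a as → All (_∈ xs) (a ∷ as) → countSum (a ∷ as) xs ≤ suc n →
             ∃ λ t → trie proj₁ (3 + n) (codesGo n xs 0 (a ∷ as)) ≡ just t × paths t ≡ codesGo n xs 0 (a ∷ as)
  codeTrie n xs a as as⊆ bound =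
    trie-paths proj₁ (3 + n) _ _ (codesGo-sorted n xs 0 (a ∷ as) as⊆ bound , codesGo-bounded n xs 0 (a ∷ as) as⊆)

  treeT-just : ∀ n xs → length xs ≡ suc n → ∃ λ t → treeT n xs ≡ just t
  treeT-just n xs@(x ∷ _) |xs|≡1+n
    with distinctSorted xs in eq | distinctSorted⊆ xs | count#-distinctSorted≤1 xs
  ... | []     | _   | _  = ⊥-elim (isort≢[] (deduplicate _≟_ xs) (λ ()) eq)
  ... | a ∷ as | as⊆ | ≤1 =
    map₂ proj₁ (codeTrie n xs a as as⊆ (≤-trans (countSum≤length (a ∷ as) ≤1 xs) (≤-reflexive |xs|≡1+n)))

  term-∷ : ∀ p ps x → term (p ∷ ps) x ≡ clog (suc (length ps)) (1 ⊔ count# x (p ∷ ps)) + 3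
  term-∷ p ps x with count# x (p ∷ ps)
  ... | zero  = refl
  ... | suc _ = refl

-- Order embeddings

module StrictOrder {A : Set} {_≤A_ : A → A → Set} (O : IsDecTotalOrder _≡_ _≤A_) where
  private
    open IsDecTotalOrder O using (antisym; reflexive; ≤-respˡ-≈) renaming (trans to ≤A-trans)
    decTotalOrder : DecTotalOrder _ _ _
    decTotalOrder = record { isDecTotalOrder = O }
  open import Relation.Binary.Properties.DecTotalOrder decTotalOrder public
    using (<⇒≉) renaming (_<_ to _<A_; ≰⇒> to ≰A⇒>; <⇒≱ to <A⇒≱A)

  ≤-<A-trans : ∀ {a b c} → a ≤A b → b <A c → a <A c
  ≤-<A-trans = ToStrict.≤-<-trans _≡_ _≤A_ ≤A-trans antisym ≤-respˡ-≈

  StrictlyIncreasing : ∀ {t} → (Fin t → A) → Set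
  StrictlyIncreasing f = ∀ {i j} → i Fin.< j → f i <A f j

  module _ {t} {f : Fin t → A} (f-strict : StrictlyIncreasing f) where

    increasing⇒monotone : ∀ {i j} → i Fin.≤ j → f i ≤A f j
    increasing⇒monotone i≤j with m≤n⇒m<n∨m≡n i≤j
    ... | inj₁ i<j = proj₁ (f-strict i<j)
    ... | inj₂ i≡j = reflexive (cong f (FinProps.toℕ-injective i≡j))

    increasing⇒embedding : ∀ {i j} → i Fin.≤ j ⇔ f i ≤A f j
    increasing⇒embedding = mk⇔ increasing⇒monotone (λ fi≤fj → ≮⇒≥ (λ j<i → <A⇒≱A (f-strict j<i) fi≤fj))

module Transfer {A B : Set} {_≤A_ : A → A → Set} {_≤B_ : B → B → Set}
                (OA : IsDecTotalOrder _≡_ _≤A_) (OB : IsDecTotalOrder _≡_ _≤B_)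
                (g : B → A) (g-≤ : ∀ {x y} → x ≤B y ⇔ g x ≤A g y) where
  private
    module SA = Seq OA
    module SB = Seq OB
    open IsDecTotalOrder OA using () renaming (_≟_ to _≟A_; _≤?_ to _≤?A_; antisym to antisymA)
    open IsDecTotalOrder OB using () renaming (_≟_ to _≟B_; _≤?_ to _≤?B_; antisym to antisymB)

  g-injective : ∀ {x y} → g x ≡ g y → x ≡ y
  g-injective {x} {y} gx≡gy = antisymB (Equivalence.from (g-≤ {x} {y}) (≤-reflexiveA gx≡gy))
                                       (Equivalence.from (g-≤ {y} {x}) (≤-reflexiveA (sym gx≡gy)))
    where open IsDecTotalOrder OA using () renaming (reflexive to ≤-reflexiveA)

  does-≟ : ∀ x y → does (g x ≟A g y) ≡ does (x ≟B y)
  does-≟ x y = does-⇔ (mk⇔ (g-injective {x} {y}) (cong g)) (g x ≟A g y) (x ≟B y)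

  does-≤? : ∀ x y → does (g x ≤?A g y) ≡ does (x ≤?B y)
  does-≤? x y = does-⇔ (mk⇔ (Equivalence.from (g-≤ {x} {y})) (Equivalence.to g-≤)) (g x ≤?A g y) (x ≤?B y)

  count#-map : ∀ a xs → SA.count# (g a) (map g xs) ≡ SB.count# a xs
  count#-map a []       = refl
  count#-map a (x ∷ xs) rewrite does-≟ x a with does (x ≟B a)
  ... | true  = cong suc (count#-map a xs)
  ... | false = count#-map a xs

  indicesFrom-map : ∀ k a xs → SA.indicesFrom k (g a) (map g xs) ≡ SB.indicesFrom k a xs
  indicesFrom-map k a []       = refl
  indicesFrom-map k a (x ∷ xs) rewrite does-≟ x a with does (x ≟B a)
  ... | true  = cong (k ∷_) (indicesFrom-map (suc k) a xs)
  ... | false = indicesFrom-map (suc k) a xs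

  filter-≢-map : ∀ x l → filter (λ y → ¬? (g x ≟A y)) (map g l) ≡ map g (filter (λ y → ¬? (x ≟B y)) l)
  filter-≢-map x []      = refl
  filter-≢-map x (y ∷ l) rewrite does-≟ x y with does (x ≟B y)
  ... | true  = filter-≢-map x l
  ... | false = cong (g y ∷_) (filter-≢-map x l)

  deduplicate-map : ∀ l → deduplicate _≟A_ (map g l) ≡ map g (deduplicate _≟B_ l)
  deduplicate-map []      = refl
  deduplicate-map (x ∷ l) =
    cong (g x ∷_) (trans (cong (filter (λ y → ¬? (g x ≟A y))) (deduplicate-map l))
                         (filter-≢-map x (deduplicate _≟B_ l)))

  insert-map : ∀ a l → SA.insert (g a) (map g l) ≡ map g (SB.insert a l)
  insert-map a []      = refl
  insert-map a (y ∷ l) rewrite does-≤? a y with does (a ≤?B y)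
  ... | true  = refl
  ... | false = cong (g y ∷_) (insert-map a l)

  isort-map : ∀ l → SA.isort (map g l) ≡ map g (SB.isort l)
  isort-map []      = refl
  isort-map (a ∷ l) = trans (cong (SA.insert (g a)) (isort-map l)) (insert-map a (SB.isort l))

  distinctSorted-map : ∀ l → SA.distinctSorted (map g l) ≡ map g (SB.distinctSorted l)
  distinctSorted-map l = trans (cong SA.isort (deduplicate-map l)) (isort-map (deduplicate _≟B_ l))

  relabel : SB.LeafData → SA.LeafData
  relabel (a , c , is) = g a , c , is

  codesGo-map : ∀ n xs C as → SA.codesGo n (map g xs) C (map g as) ≡ map (map₂ relabel) (SB.codesGo n xs C as)
  codesGo-map n xs C []       = refl
  codesGo-map n xs C (a ∷ as) rewrite count#-map a xs | indicesFrom-map 1 a xs =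
    cong (_ ∷_) (codesGo-map n xs (C + SB.count# a xs) as)

  treeT-map : ∀ n xs → SA.treeT n (map g xs) ≡ Maybe.map (mapTree relabel g) (SB.treeT n xs)
  treeT-map n xs = begin
    trie proj₁ (3 + n) (SA.codesGo n (map g xs) 0 (SA.distinctSorted (map g xs)))
      ≡⟨ cong (λ as → trie proj₁ (3 + n) (SA.codesGo n (map g xs) 0 as)) (distinctSorted-map xs) ⟩
    trie proj₁ (3 + n) (SA.codesGo n (map g xs) 0 (map g (SB.distinctSorted xs)))
      ≡⟨ cong (trie proj₁ (3 + n)) (codesGo-map n xs 0 (SB.distinctSorted xs)) ⟩
    trie proj₁ (3 + n) (map (map₂ relabel) (SB.codes n xs))
      ≡⟨ trie-map proj₁ proj₁ relabel g (λ _ → refl) (3 + n) (SB.codes n xs) ⟩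
    Maybe.map (mapTree relabel g) (SB.treeT n xs) ∎
    where open ≡-Reasoning

-- Searching with comparisons

infixl 1 _>>=_
_>>=_ : ∀ {m X Y} → CompTree m X → (X → CompTree m Y) → CompTree m Y
ret x     >>= f = f x
ask i j c >>= f = ask i j (λ b → c b >>= f)

module _ {A : Set} {_≤A_ : A → A → Set} (O : IsDecTotalOrder _≡_ _≤A_) {m : ℕ} (s : Vec A m) where

  run->>= : ∀ {X Y} (c : CompTree m X) (f : X → CompTree m Y) →
            run O s (c >>= f) ≡ (proj₁ (run O s (f (proj₁ (run O s c)))) ,
                                 proj₂ (run O s c) + proj₂ (run O s (f (proj₁ (run O s c)))))
  run->>= (ret x)     f = refl
  run->>= (ask i j c) f = cong (λ r → proj₁ r , suc (proj₂ r)) (run->>= (c _) f)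

-- hit r: equal to the representative of rank r; gap q: strictly between those of ranks q − 1 and q.
data Position (t : ℕ) : Set where
  hit : Fin t → Position t
  gap : Fin (suc t) → Position t

module _ {m t : ℕ} (reps : Vec (Fin m) t) (k : Fin m) where

  settle : Fin t → CompTree m (Position t)
  settle r = ask k (lookup reps r) λ where
    true  → ask (lookup reps r) k λ where
      true  → ret (hit r)
      false → ret (gap (inject₁ r))
    false → ret (gap (Fin.suc r))

  -- The pointer stored at a binary node is recomputed as the rank of `rightmost l`, at no cost.
  locate : {B P : Set} → BTree (Fin t × B) P → CompTree m (Position t)
  locate (leaf (r , _)) = settle r
  locate (onlyL u)      = locate u
  locate (onlyR u)      = locate u
  locate (both l _ r)   = ask k (lookup reps (proj₁ (rightmost l))) λ where
    true  → locate l
    false → locate r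

leafRanks : {t : ℕ} {B P : Set} → BTree (Fin t × B) P → List (Fin t)
leafRanks (leaf (r , _)) = r ∷ []
leafRanks (onlyL u)      = leafRanks u
leafRanks (onlyR u)      = leafRanks u
leafRanks (both l _ r)   = leafRanks l ++ leafRanks r

leafRanks-paths : {t : ℕ} {B P : Set} (u : BTree (Fin t × B) P) → map (λ e → proj₁ (proj₂ e)) (paths u) ≡ leafRanks u
leafRanks-paths (leaf _)     = refl
leafRanks-paths (onlyL u)    = trans (sym (map-∘ (paths u))) (leafRanks-paths u)
leafRanks-paths (onlyR u)    = trans (sym (map-∘ (paths u))) (leafRanks-paths u)
leafRanks-paths {t} {B} (both l _ r) = begin
  map rank (tag false (paths l) ++ tag true (paths r))       ≡⟨ map-++ rank (tag false (paths l)) _ ⟩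
  map rank (tag false (paths l)) ++ map rank (tag true (paths r))
    ≡⟨ cong₂ _++_ (trans (sym (map-∘ (paths l))) (leafRanks-paths l))
                  (trans (sym (map-∘ (paths r))) (leafRanks-paths r)) ⟩
  leafRanks l ++ leafRanks r                                         ∎
  where
  open ≡-Reasoning
  rank : List Bool × (Fin t × B) → Fin t
  rank e = proj₁ (proj₂ e)

Consecutive : {t : ℕ} → ℕ → List (Fin t) → Set
Consecutive lo []       = ⊤
Consecutive lo (r ∷ rs) = toℕ r ≡ lo × Consecutive (suc lo) rs

Consecutive-++ : ∀ {t} lo (rs rs′ : List (Fin t)) → Consecutive lo (rs ++ rs′) →
                 Consecutive lo rs × Consecutive (lo + length rs) rs′
Consecutive-++ lo []       rs′ c       = tt , subst (λ l → Consecutive l rs′) (sym (+-identityʳ lo)) c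
Consecutive-++ lo (r ∷ rs) rs′ (e , c) with Consecutive-++ (suc lo) rs rs′ c
... | c₁ , c₂ = (e , c₁) , subst (λ l → Consecutive l rs′) (sym (+-suc lo (length rs))) c₂

Consecutive-tabulate : ∀ {t n} lo (f : Fin n → Fin t) → (∀ i → toℕ (f i) ≡ lo + toℕ i) →
                       Consecutive lo (tabulate f)
Consecutive-tabulate {n = zero}  lo f f≗ = tt
Consecutive-tabulate {n = suc n} lo f f≗ =
  trans (f≗ Fin.zero) (+-identityʳ lo) ,
  Consecutive-tabulate (suc lo) (λ i → f (Fin.suc i)) (λ i → trans (f≗ (Fin.suc i)) (+-suc lo (toℕ i)))

rightmost-rank : ∀ {t B P} lo (u : BTree (Fin t × B) P) → Consecutive lo (leafRanks u) →
                 suc (toℕ (proj₁ (rightmost u))) ≡ lo + length (leafRanks u)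
rightmost-rank lo (leaf _)     (e , _) = trans (cong suc e) (sym (+-comm lo 1))
rightmost-rank lo (onlyL u)    c       = rightmost-rank lo u c
rightmost-rank lo (onlyR u)    c       = rightmost-rank lo u c
rightmost-rank lo (both l _ r) c with Consecutive-++ lo (leafRanks l) (leafRanks r) c
... | _ , cr = trans (rightmost-rank (lo + length (leafRanks l)) r cr)
                     (trans (+-assoc lo _ _) (cong (lo +_) (sym (length-++ (leafRanks l)))))

module LocateCorrect {A : Set} {_≤A_ : A → A → Set} (O : IsDecTotalOrder _≡_ _≤A_)
                     {m t : ℕ} (s : Vec A m) (reps : Vec (Fin m) t) (k : Fin m) where
  open StrictOrder O
  open IsDecTotalOrder O using (antisym; _≤?_)

  g : Fin t → A
  g r = lookup s (lookup reps r)

  x : A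
  x = lookup s k

  Below Above : ℕ → Set
  Below lo = ∀ r → toℕ r < lo → g r <A x
  Above hi = ∀ r → hi ≤ toℕ r → x <A g r

  Correct : Position t → Set
  Correct (hit r) = x ≡ g r
  Correct (gap q) = Below (toℕ q) × Above (toℕ q)

  Agrees : Position t → Fin t → Set
  Agrees (hit r) r′ = r′ ≡ r
  Agrees (gap _) _  = ⊤

  Reached : {B : Set} → List (List Bool × (Fin t × B)) → Position t → ℕ → Set
  Reached ps res c = ∃ λ e → e ∈ ps × c ≤ 2 + length (proj₁ e) × Agrees res (proj₁ (proj₂ e))

  LocateSpec : {B P : Set} → BTree (Fin t × B) P → Position t × ℕ → Set
  LocateSpec u (res , c) = Correct res × Reached (paths u) res c

  module _ {B : Set} where
    Reached-tag : ∀ b {ps : List (List Bool × (Fin t × B))} {res c} → Reached ps res c → Reached (tag b ps) res (suc c)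
    Reached-tag b (e , e∈ , c≤ , agrees) = map₁ (b ∷_) e , ∈-map⁺ (map₁ (b ∷_)) e∈ , s≤s c≤ , agrees

    Reached-++ˡ : ∀ {ps} qs {res c} → Reached {B} ps res c → Reached (ps ++ qs) res c
    Reached-++ˡ qs (e , e∈ , c≤ , agrees) = e , ∈-++⁺ˡ e∈ , c≤ , agrees

    Reached-++ʳ : ∀ ps {qs res c} → Reached {B} qs res c → Reached (ps ++ qs) res c
    Reached-++ʳ ps (e , e∈ , c≤ , agrees) = e , ∈-++⁺ʳ ps e∈ , c≤ , agrees

    Reached-pred : ∀ {ps res c} → Reached {B} ps res (suc c) → Reached ps res c
    Reached-pred (e , e∈ , c≤ , agrees) = e , e∈ , ≤-trans (n≤1+n _) c≤ , agrees

  module _ (g-strict : StrictlyIncreasing g) where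

    settle-correct : ∀ {B P : Set} r (b : B) → Below (toℕ r) → Above (suc (toℕ r)) →
                     LocateSpec {B} {P} (leaf (r , b)) (run O s (settle reps k r))
    settle-correct r b below above with x ≤? g r
    ... | no x≰gr = (below′ , above) , _ , here refl , s≤s z≤n , tt
      where
      below′ : Below (suc (toℕ r))
      below′ r′ (s≤s r′≤r) with m≤n⇒m<n∨m≡n r′≤r
      ... | inj₁ r′<r = below r′ r′<r
      ... | inj₂ r′≡r rewrite FinProps.toℕ-injective r′≡r = ≰A⇒> x≰gr
    ... | yes x≤gr with g r ≤? x
    ...   | yes gr≤x = antisym x≤gr gr≤x , _ , here refl , s≤s (s≤s z≤n) , refl
    ...   | no gr≰x  = (below′ , above′) , _ , here refl , s≤s (s≤s z≤n) , tt
      where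
      below′ : Below (toℕ (inject₁ r))
      below′ r′ r′<r = below r′ (subst (toℕ r′ <_) (FinProps.toℕ-inject₁ r) r′<r)
      above′ : Above (toℕ (inject₁ r))
      above′ r′ r≤r′ with m≤n⇒m<n∨m≡n (subst (_≤ toℕ r′) (FinProps.toℕ-inject₁ r) r≤r′)
      ... | inj₁ r<r′ = above r′ r<r′
      ... | inj₂ r≡r′ rewrite FinProps.toℕ-injective r≡r′ = ≰A⇒> gr≰x

    locate-correct : ∀ {B P : Set} (u : BTree (Fin t × B) P) lo → Consecutive lo (leafRanks u) →
                     Below lo → Above (lo + length (leafRanks u)) → LocateSpec u (run O s (locate reps k u))
    locate-correct {P = P} (leaf (r , b)) lo (r≡lo , _) below above =
      settle-correct {P = P} r b (subst Below (sym r≡lo) below) (subst Above (trans (+-comm lo 1) (cong suc (sym r≡lo))) above)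
    locate-correct (onlyL u) lo c below above =
      map₂ (Reached-pred ∘ Reached-tag false) (locate-correct u lo c below above)
    locate-correct (onlyR u) lo c below above =
      map₂ (Reached-pred ∘ Reached-tag true) (locate-correct u lo c below above)
    locate-correct (both l _ r) lo c below above
      with Consecutive-++ lo (leafRanks l) (leafRanks r) c | x ≤? g (proj₁ (rightmost l))
    ... | cl , cr | yes x≤rm =
      map₂ (Reached-++ˡ (tag true (paths r)) ∘ Reached-tag false) (locate-correct l lo cl below aboveL)
      where
      aboveL : Above (lo + length (leafRanks l))
      aboveL r′ le = ≤-<A-trans x≤rm (g-strict (subst (_≤ toℕ r′) (sym (rightmost-rank lo l cl)) le))
    ... | cl , cr | no x≰rm =
      map₂ (Reached-++ʳ (tag false (paths l)) ∘ Reached-tag true)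
           (locate-correct r (lo + length (leafRanks l)) cr belowR aboveR)
      where
      belowR : Below (lo + length (leafRanks l))
      belowR r′ lt = ≤-<A-trans
        (increasing⇒monotone g-strict (≤-pred (subst (toℕ r′ <_) (sym (rightmost-rank lo l cl)) lt))) (≰A⇒> x≰rm)
      aboveR : Above (lo + length (leafRanks l) + length (leafRanks r))
      aboveR = subst Above (trans (cong (lo +_) (length-++ (leafRanks l))) (sym (+-assoc lo _ _))) above

-- The procedure

module FinSeq (t : ℕ) = Seq (FinProps.≤-isDecTotalOrder {t})
module FinCodes (t : ℕ) = Codes (FinProps.≤-isDecTotalOrder {t})

-- After s₁ … s_i: `reps` holds an index into S of each distinct value, in increasing order of value,
-- and `ranks` the rank of each s_j among them.
record State (m : ℕ) : Set where
  constructor state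
  field
    size  : ℕ
    reps  : Vec (Fin m) size
    ranks : List (Fin size)

-- T_i of the rank sequence, with its distinct values listed directly as allFin t (every rank
-- occurs), so that its leaves carry the ranks 0, 1, …, t − 1 from left to right.
rankTree : ∀ {t} → List (Fin t) → Maybe (BTree (Fin t × ℕ × List ℕ) (Fin t))
rankTree {t} rs = trie proj₁ (3 + n) (FinSeq.codesGo t n rs 0 (allFin t))
  where
  n : ℕ
  n = pred (length rs)

module _ {m : ℕ} (k : Fin m) where

  -- rankTree fails only for the empty state, where gap 0 is the right answer.
  search : (st : State m) → CompTree m (Position (State.size st))
  search (state t reps rs) = maybe′ (locate reps k) (ret (gap Fin.zero)) (rankTree rs)

  extend : (st : State m) → Position (State.size st) → State m
  extend (state t reps rs) (hit r) = state t reps (rs ++ r ∷ [])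
  extend (state t reps rs) (gap q) = state (suc t) (insertAt reps q k) (map (punchIn q) rs ++ q ∷ [])

  step : State m → CompTree m (State m)
  step st = search st >>= λ pos → ret (extend st pos)

scan : ∀ {m} → State m → List (Fin m) → CompTree m (State m)
scan st []       = ret st
scan st (k ∷ ks) = step k st >>= λ st′ → scan st′ ks

-- The default leaf is never returned: the tree exists for every nonempty input (treeT-just).
output : ∀ n → State (suc n) → Out (suc n)
output n (state t reps rs) =
  maybe′ (mapTree (map₁ (lookup reps)) (lookup reps)) (leaf (Fin.zero , 0 , [])) (FinSeq.treeT t n rs)

procedure : (n : ℕ) → CompTree (suc n) (Out (suc n))
procedure n = scan (state 0 [] []) (allFin (suc n)) >>= λ st → ret (output n st)

-- Correctness

rankTree-paths : ∀ {t} (r : Fin t) rs → (∀ a → a ∈ r ∷ rs) →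
                 ∃ λ tr → rankTree (r ∷ rs) ≡ just tr
                        × paths tr ≡ FinSeq.codesGo t (length rs) (r ∷ rs) 0 (allFin t)
rankTree-paths {suc t} r rs covered =
  codeTrie (length rs) (r ∷ rs) Fin.zero (tabulate Fin.suc) (tabulate⁺ covered)
    (countSum≤length (allFin (suc t)) (λ a → count#≤1 (allFin⁺ (suc t))) (r ∷ rs))
  where open Codes (FinProps.≤-isDecTotalOrder {suc t})

leafRanks-codeTree : ∀ {t} n rs (tr : BTree (Fin t × ℕ × List ℕ) (Fin t)) →
                     paths tr ≡ FinSeq.codesGo t n rs 0 (allFin t) → leafRanks tr ≡ allFin t
leafRanks-codeTree {t} n rs tr pt = begin
  leafRanks tr                                             ≡⟨ leafRanks-paths tr ⟨
  map (λ e → proj₁ (proj₂ e)) (paths tr)                   ≡⟨ cong (map (λ e → proj₁ (proj₂ e))) pt ⟩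
  map (λ e → proj₁ (proj₂ e)) (FinSeq.codesGo t n rs 0 (allFin t)) ≡⟨ FinCodes.codesGo-ranks t n rs 0 (allFin t) ⟩
  allFin t                                                 ∎
  where open ≡-Reasoning

data PunchView {t} (q : Fin (suc t)) : Fin (suc t) → Set where
  at-q    : PunchView q q
  punched : ∀ r → PunchView q (punchIn q r)

punchView : ∀ {t} (q a : Fin (suc t)) → PunchView q a
punchView q a with q Fin.≟ a
... | yes refl = at-q
... | no q≢a   = subst (PunchView q) (FinProps.punchIn-punchOut q≢a) (punched (Fin.punchOut q≢a))

punchIn<⇒< : ∀ {t} (q : Fin (suc t)) r → punchIn q r Fin.< q → r Fin.< q
punchIn<⇒< (Fin.suc q) Fin.zero    _         = s≤s z≤n
punchIn<⇒< (Fin.suc q) (Fin.suc r) (s≤s lt) = s≤s (punchIn<⇒< q r lt)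

<punchIn⇒≤ : ∀ {t} (q : Fin (suc t)) r → q Fin.< punchIn q r → q Fin.≤ r
<punchIn⇒≤ Fin.zero    r           _        = z≤n
<punchIn⇒≤ (Fin.suc q) (Fin.suc r) (s≤s lt) = s≤s (<punchIn⇒≤ q r lt)

punchIn-cancel-< : ∀ {t} (q : Fin (suc t)) r r′ → punchIn q r Fin.< punchIn q r′ → r Fin.< r′
punchIn-cancel-< Fin.zero    r           r′           (s≤s lt) = lt
punchIn-cancel-< (Fin.suc q) Fin.zero    (Fin.suc r′) _        = s≤s z≤n
punchIn-cancel-< (Fin.suc q) (Fin.suc r) (Fin.suc r′) (s≤s lt) = s≤s (punchIn-cancel-< q r r′ lt)

module Correctness {A : Set} {_≤A_ : A → A → Set} (O : IsDecTotalOrder _≡_ _≤A_) {m : ℕ} (s : Vec A m) where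
  open StrictOrder O
  open Codes O using (term-∷; count#-∉)
  module SA = Seq O

  rep : (st : State m) → Fin (State.size st) → A
  rep (state _ reps _) r = lookup s (lookup reps r)

  record Invariant (st : State m) (P : List A) : Set where
    field
      increasing : StrictlyIncreasing (rep st)
      prefix     : P ≡ map (rep st) (State.ranks st)
      covered    : ∀ r → r ∈ State.ranks st
  open Invariant

  module _ (k : Fin m) {t} (reps : Vec (Fin m) t) (rs : List (Fin t)) where
    open LocateCorrect O s reps k

    count-bound : StrictlyIncreasing g → (∀ r → r ∈ rs) → ∀ pos r → Correct pos → Agrees pos r →
                  1 ⊔ SA.count# x (map g rs) ≤ FinSeq.count# t r rs
    count-bound inc covered (hit r) .r x≡gr refl = ≤-reflexive (begin
      1 ⊔ SA.count# x (map g rs)      ≡⟨ cong (λ y → 1 ⊔ SA.count# y (map g rs)) x≡gr ⟩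
      1 ⊔ SA.count# (g r) (map g rs)  ≡⟨ cong (1 ⊔_) (count#-map r rs) ⟩
      1 ⊔ FinSeq.count# t r rs        ≡⟨ m≤n⇒m⊔n≡n (FinCodes.∈⇒1≤count# t (covered r)) ⟩
      FinSeq.count# t r rs            ∎)
      where
      open ≡-Reasoning
      open Transfer O FinProps.≤-isDecTotalOrder g (increasing⇒embedding inc) using (count#-map)
    count-bound inc covered (gap q) r (below , above) _ =
      subst (λ c → 1 ⊔ c ≤ FinSeq.count# t r rs) (sym (count#-∉ (map g rs) (map⁺ (universal x≢g rs))))
            (FinCodes.∈⇒1≤count# t (covered r))
      where
      x≢g : ∀ r′ → x ≢ g r′
      x≢g r′ with toℕ r′ <? toℕ q
      ... | yes r′<q = λ x≡gr′ → <⇒≉ (below r′ r′<q) (sym x≡gr′)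
      ... | no r′≮q  = <⇒≉ (above r′ (≮⇒≥ r′≮q))

  search-correct : ∀ k (st : State m) → StrictlyIncreasing (rep st) → (∀ r → r ∈ State.ranks st) →
                   LocateCorrect.Correct O s (State.reps st) k (proj₁ (run O s (search k st)))
                   × proj₂ (run O s (search k st)) ≤ SA.term (map (rep st) (State.ranks st)) (lookup s k)
  search-correct k (state zero    reps [])       _   _       = ((λ ()) , (λ ())) , z≤n
  search-correct k (state (suc t) reps [])       _   covered with () ← covered Fin.zero
  search-correct k (state t       reps (r ∷ rs)) inc covered with rankTree-paths r rs covered
  ... | tr , eq , pt rewrite eq = proj₁ spec , cost spec
    where
    open LocateCorrect O s reps k
    n : ℕ
    n = length rs
    leafRanks≡allFin : leafRanks tr ≡ allFin t
    leafRanks≡allFin = leafRanks-codeTree n (r ∷ rs) tr pt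
    above : Above (0 + length (leafRanks tr))
    above r′ t≤r′ = ⊥-elim (<⇒≱ (FinProps.toℕ<n r′)
      (subst (_≤ toℕ r′) (trans (cong length leafRanks≡allFin) (length-tabulate (λ i → i))) t≤r′))
    spec : LocateSpec tr (run O s (locate reps k tr))
    spec = locate-correct inc tr 0
      (subst (Consecutive 0) (sym leafRanks≡allFin) (Consecutive-tabulate 0 (λ i → i) (λ _ → refl))) (λ _ ()) above
    cost : ∀ {pos c} → LocateSpec tr (pos , c) → c ≤ SA.term (map g (r ∷ rs)) x
    cost {pos} {c} (correct , e , e∈ , c≤ , agrees) = begin
      c                                                       ≤⟨ c≤ ⟩
      2 + length (proj₁ e)
        ≡⟨ cong (2 +_) (All.lookup (FinCodes.codesGo-lengths t n (r ∷ rs) 0 (allFin t)) (subst (e ∈_) pt e∈)) ⟩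
      3 + clog (suc n) (FinSeq.count# t (proj₁ (proj₂ e)) (r ∷ rs))
        ≤⟨ +-monoʳ-≤ 3 (clog-antitone (suc n) (m≤m⊔n 1 (SA.count# x (map g (r ∷ rs))))
                                       (count-bound k reps (r ∷ rs) inc covered pos _ correct agrees)) ⟩
      3 + clog (suc n) (1 ⊔ SA.count# x (map g (r ∷ rs)))     ≡⟨ +-comm 3 _ ⟩
      clog (suc n) (1 ⊔ SA.count# x (map g (r ∷ rs))) + 3
        ≡⟨ cong (λ l → clog (suc l) (1 ⊔ SA.count# x (map g (r ∷ rs))) + 3) (length-map g rs) ⟨
      clog (suc (length (map g rs))) (1 ⊔ SA.count# x (map g (r ∷ rs))) + 3
        ≡⟨ term-∷ (g r) (map g rs) x ⟨
      SA.term (map g (r ∷ rs)) x                              ∎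
      where open ≤-Reasoning

  extend-invariant : ∀ k st {P} → Invariant st P → ∀ pos → LocateCorrect.Correct O s (State.reps st) k pos →
                     Invariant (extend k st pos) (P ++ lookup s k ∷ [])
  extend-invariant k (state t reps rs) inv (hit r) x≡gr = record
    { increasing = increasing inv
    ; prefix     = trans (cong₂ (λ P y → P ++ y ∷ []) (prefix inv) x≡gr) (sym (map-++ _ rs (r ∷ [])))
    ; covered    = λ a → ∈-++⁺ˡ (covered inv a)
    }
  extend-invariant k (state t reps rs) {P} inv (gap q) (below , above) = record
    { increasing = increasing′
    ; prefix     = prefix′
    ; covered    = covered′
    }
    where
    open LocateCorrect O s reps k using (g; x)
    g′ : Fin (suc t) → A
    g′ a = lookup s (lookup (insertAt reps q k) a)
    g′-punchIn : ∀ r → g′ (punchIn q r) ≡ g r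
    g′-punchIn r = cong (lookup s) (VecProps.insertAt-punchIn reps q k r)
    g′-q : g′ q ≡ x
    g′-q = cong (lookup s) (VecProps.insertAt-lookup reps q k)
    increasing′ : StrictlyIncreasing g′
    increasing′ {i} {j} i<j with punchView q i | punchView q j
    ... | at-q      | at-q       = ⊥-elim (<-irrefl refl i<j)
    ... | at-q      | punched r  = subst₂ _<A_ (sym g′-q) (sym (g′-punchIn r)) (above r (<punchIn⇒≤ q r i<j))
    ... | punched r | at-q       = subst₂ _<A_ (sym (g′-punchIn r)) (sym g′-q) (below r (punchIn<⇒< q r i<j))
    ... | punched r | punched r′ = subst₂ _<A_ (sym (g′-punchIn r)) (sym (g′-punchIn r′))
                                          (increasing inv (punchIn-cancel-< q r r′ i<j))
    prefix′ : P ++ x ∷ [] ≡ map g′ (map (punchIn q) rs ++ q ∷ [])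
    prefix′ = begin
      P ++ x ∷ []                                   ≡⟨ cong (_++ x ∷ []) (prefix inv) ⟩
      map g rs ++ x ∷ []
        ≡⟨ cong₂ (λ u y → u ++ y ∷ []) (map-cong (sym ∘ g′-punchIn) rs) (sym g′-q) ⟩
      map (g′ ∘ punchIn q) rs ++ g′ q ∷ []          ≡⟨ cong (_++ g′ q ∷ []) (map-∘ rs) ⟩
      map g′ (map (punchIn q) rs) ++ g′ q ∷ []      ≡⟨ map-++ g′ (map (punchIn q) rs) (q ∷ []) ⟨
      map g′ (map (punchIn q) rs ++ q ∷ [])         ∎
      where open ≡-Reasoning
    covered′ : ∀ a → a ∈ map (punchIn q) rs ++ q ∷ []
    covered′ a with punchView q a
    ... | at-q      = ∈-++⁺ʳ (map (punchIn q) rs) (here refl)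
    ... | punched r = ∈-++⁺ˡ (∈-map⁺ (punchIn q) (covered inv r))

  step-correct : ∀ k st {P} → Invariant st P →
                 Invariant (proj₁ (run O s (step k st))) (P ++ lookup s k ∷ [])
                 × proj₂ (run O s (step k st)) ≤ SA.term P (lookup s k)
  step-correct k st {P} inv rewrite run->>= O s (search k st) (λ pos → ret (extend k st pos))
    with search-correct k st (increasing inv) (covered inv)
  ... | correct , c≤term =
    extend-invariant k st inv _ correct ,
    ≤-trans (≤-reflexive (+-identityʳ _)) (subst (λ P → _ ≤ SA.term P (lookup s k)) (sym (prefix inv)) c≤term)

  scan-correct : ∀ ks st {P} → Invariant st P →
                 Invariant (proj₁ (run O s (scan st ks))) (P ++ map (lookup s) ks)
                 × proj₂ (run O s (scan st ks)) ≤ SA.boundGo P (map (lookup s) ks)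
  scan-correct []       st {P} inv = subst (Invariant st) (sym (++-identityʳ P)) inv , z≤n
  scan-correct (k ∷ ks) st {P} inv rewrite run->>= O s (step k st) (λ st′ → scan st′ ks)
    with run O s (step k st) | step-correct k st inv
  ... | st′ , _ | inv′ , c≤term with scan-correct ks st′ inv′
  ...   | inv″ , c′≤bound =
    subst (Invariant _) (++-assoc P (lookup s k ∷ []) (map (lookup s) ks)) inv″ , +-mono-≤ c≤term c′≤bound

  length-ranks : ∀ {st P} → Invariant st P → length (State.ranks st) ≡ length P
  length-ranks {st} inv = trans (sym (length-map (rep st) (State.ranks st))) (cong length (sym (prefix inv)))

  initial : Invariant (state 0 [] []) []
  initial = record { increasing = λ {i} → ⊥-elim (FinProps.¬Fin0 i) ; prefix = refl ; covered = λ () }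

map-lookup-allFin : ∀ {A : Set} {n} (s : Vec A n) → map (lookup s) (allFin n) ≡ toList s
map-lookup-allFin []                = refl
map-lookup-allFin {n = suc n} (x ∷ s) = cong (x ∷_) (begin
  map (lookup (x ∷ s)) (tabulate Fin.suc)  ≡⟨ map-tabulate Fin.suc (lookup (x ∷ s)) ⟩
  tabulate (lookup s)                      ≡⟨ map-tabulate (λ i → i) (lookup s) ⟨
  map (lookup s) (allFin n)                ≡⟨ map-lookup-allFin s ⟩
  toList s                                 ∎)
  where open ≡-Reasoning

module Theorem {A : Set} {_≤A_ : A → A → Set} (O : IsDecTotalOrder _≡_ _≤A_) (n : ℕ) (s : Vec A (suc n)) where
  open Correctness O s
  open Invariant
  open StrictOrder O using (increasing⇒embedding)

  output-correct : ∀ st → Invariant st (toList s) → Seq.treeT O n (toList s) ≡ just (decode s (output n st))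
  output-correct (state t reps rs) inv
    with FinCodes.treeT-just t n rs (trans (length-ranks inv) (VecProps.length-toList s))
  ... | tr , eq rewrite eq = begin
    Seq.treeT O n (toList s)                              ≡⟨ cong (Seq.treeT O n) (prefix inv) ⟩
    Seq.treeT O n (map g rs)                              ≡⟨ treeT-map n rs ⟩
    Maybe.map (mapTree relabel g) (FinSeq.treeT t n rs)   ≡⟨ cong (Maybe.map (mapTree relabel g)) eq ⟩
    just (mapTree relabel g tr)                           ≡⟨ cong just (mapTree-∘ _ _ _ _ tr) ⟨
    just (decode s (mapTree (map₁ (lookup reps)) (lookup reps) tr)) ∎
    where
    open ≡-Reasoning
    g : Fin t → A
    g = rep (state t reps rs)
    open Transfer O FinProps.≤-isDecTotalOrder g (increasing⇒embedding (increasing inv)) using (treeT-map; relabel)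

  theorem : Seq.treeT O n (toList s) ≡ just (decode s (proj₁ (run O s (procedure n))))
            × proj₂ (run O s (procedure n)) ≤ Seq.bound O (toList s)
  theorem rewrite run->>= O s (scan (state 0 [] []) (allFin (suc n))) (λ st → ret (output n st))
    with run O s (scan (state 0 [] []) (allFin (suc n))) | scan-correct (allFin (suc n)) (state 0 [] []) initial
  ... | st , c | inv , c≤bound =
    output-correct st (subst (Invariant st) (map-lookup-allFin s) inv) ,
    ≤-trans (≤-reflexive (+-identityʳ c)) (subst (λ S → c ≤ Seq.boundGo O [] S) (map-lookup-allFin s) c≤bound)

lemma1 : Σ ((n : ℕ) → CompTree (suc n) (Out (suc n))) λ proc →
           (A : Set) (_≤A_ : A → A → Set) (O : IsDecTotalOrder _≡_ _≤A_)
           (n : ℕ) (s : Vec A (suc n)) →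
           Seq.treeT O n (toList s) ≡ just (decode s (proj₁ (run O s (proc n))))
           × proj₂ (run O s (proc n)) ≤ Seq.bound O (toList s)
lemma1 = procedure , λ A _≤A_ O n s → Theorem.theorem O n s
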